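{- Let $n\ge 20$ with $n\equiv 2\pmod 3$. Then there exists a $5$-uniform hypergraph $\mathcal{H}=(V,\mathcal{E})$ with $EI(\mathcal{H})=C_n$ and $|\mathcal{E}|=\frac{2}{3}(n-2)+1$ such that $\mathcal{H}$ contains exactly one $(5)$-hyperedge and all remaining hyperedges of $\mathcal{H}$ are $(3,2)$-hyperedges.
   Context: Hypergraphs $\mathcal{H}=(V,\mathcal{E})$ have no multiple hyperedges; isolated vertices are allowed. $\mathcal{H}$ is $5$-uniform if every hyperedge has exactly $5$ elements. The edge intersection hypergraph of $\mathcal{H}$ is $EI(\mathcal{H})=(V,\mathcal{E}^{EI})$ with $\mathcal{E}^{EI}=\{e_1\cap e_2: e_1,e_2\in\mathcal{E},\ e_1\ne e_2,\ |e_1\cap e_2|\ge 2\}$. $C_n$ is the cycle with vertex set $\{1,\dots,n\}$ and edges $\{i,i+1\}$, $i=1,\dots,n$ (vertices taken mod $n$); "$EI(\mathcal{H})=C_n$" means $V=\{1,\dots,n\}$ and $\mathcal{E}^{EI}$ is exactly the edge set of $C_n$. For $e\in\mathcal{E}$, a $k$-section of $e$ is a sequence $(i,i+1,\dots,i+k-1)$ of cyclically consecutive vertices with $\{i,\dots,i+k-1\}\subseteq e$, $i-1\notin e$, $i+k\notin e$ (mod $n$). A hyperedge $e$ is an $(l_1,\dots,l_t)$-hyperedge ($l_1\ge\dots\ge l_t$) if $e$ is the disjoint union of exactly $t$ sections, of cardinalities $l_1,\dots,l_t$. -}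

module Defs where

open import Data.Nat using (ℕ; zero; suc; _+_; _≤_)
open import Data.Nat.DivMod using (_mod_)
open import Data.Fin using (Fin; toℕ)
open import Data.Fin.Subset using (Subset; ⊥; ⁅_⁆; _∈_; _∉_; _⊆_; _∩_; _∪_; ∣_∣)
open import Data.List using (List)
import Data.List.Membership.Propositional as L
open import Data.Product using (Σ; ∃; _×_)
open import Relation.Binary.PropositionalEquality using (_≡_; _≢_)
open import Relation.Nullary using (¬_)

-- Vertices 1..n are represented by Fin n (vertex k+1 ↦ k); a hypergraph on
-- V = {1..n} is a list of hyperedges (subsets of Fin n), required elsewhere
-- to be duplicate-free (no multiple hyperedges).

next : ∀ {n} → Fin n → Fin n
next {suc m} i = suc (toℕ i) mod suc m

prev : ∀ {n} → Fin n → Fin n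
prev {suc m} i = (toℕ i + m) mod suc m

nextⁿ : ∀ {n} → ℕ → Fin n → Fin n
nextⁿ zero i = i
nextⁿ (suc k) i = next (nextⁿ k i)

seg : ∀ {n} → Fin n → ℕ → Subset n
seg i zero = ⊥
seg i (suc k) = ⁅ i ⁆ ∪ seg (next i) k

cycEdge : ∀ {n} → Fin n → Subset n
cycEdge i = ⁅ i ⁆ ∪ ⁅ next i ⁆

IsSection : ∀ {n} → Subset n → Fin n → ℕ → Set
IsSection e i k = seg i k ⊆ e × prev i ∉ e × nextⁿ k i ∉ e

InEI : ∀ {n} → List (Subset n) → Subset n → Set
InEI E X = Σ _ λ e₁ → Σ _ λ e₂ →
  e₁ L.∈ E × e₂ L.∈ E × e₁ ≢ e₂ × 2 ≤ ∣ e₁ ∩ e₂ ∣ × X ≡ e₁ ∩ e₂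

EIisCycle : ∀ {n} → List (Subset n) → Set
EIisCycle {n} E = ∀ (X : Subset n) →
  (InEI E X → ∃ λ i → X ≡ cycEdge i) × ((∃ λ i → X ≡ cycEdge i) → InEI E X)

Is5Edge : ∀ {n} → Subset n → Set
Is5Edge e = ∃ λ i → IsSection e i 5 × e ≡ seg i 5

Is32Edge : ∀ {n} → Subset n → Set
Is32Edge e = Σ _ λ i → Σ _ λ j →
  IsSection e i 3 × IsSection e j 2 × ∣ seg i 3 ∩ seg j 2 ∣ ≡ 0 ×
  e ≡ seg i 3 ∪ seg j 2

-- Write n = 20 + 3m and let the position x ∈ ℕ stand for the vertex x mod n of C_n. For i < m + 3 take
-- X i = {3i+9, 3i+10, 3i+11} ∪ {3i+2, 3i+3} and Y i = {3i+1, 3i+2, 3i+3} ∪ {3i+6, 3i+7}. The intersections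
-- X i ∩ Y i, X i ∩ Y (i+1) and X i ∩ Y (i+3) are the cycle edges at 3i+2, 3i+9 and 3i+10, and any other two
-- members of these families share at most one vertex. A seam of seven edges on the positions 3m+10, ..., 3m+28,
-- one (5)-hyperedge and six (3,2)-hyperedges, supplies the cycle edges that the families miss where they wrap
-- around, and meets every other edge in at most one vertex or in a cycle edge: 2(m+3) + 7 = 2(n-2)/3 + 1
-- hyperedges in all.
-- Reduction mod n is injective on any n consecutive positions, so there the intersection of two hyperedges is
-- computed from their lists of positions. For m ≥ 6 the seam and the family members meeting it fit in one
-- window of 38 positions, which settles the seam by a single evaluation, while members further away are
-- separated from it; the six hypergraphs with m < 6 are checked by evaluation outright.

module Submission where

open import Defs
open import Data.Nat using (ℕ; zero; suc; _+_; _*_; _∸_; _/_; _%_; _≤_; _<_; z≤n; s≤s; _≟_; _<?_; _≤?_)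
open import Data.Nat.Properties
open import Data.Nat.DivMod
  using (_mod_; m%n<n; m<n⇒m%n≡m; m%n%n≡m%n; %-distribˡ-+; [m+n]%n≡m%n; [m+kn]%n≡m%n; m≡m%n+[m/n]*n; m*n/n≡m)
open import Data.Nat.Tactic.RingSolver using (solve-∀)
import Data.Bool as Bool
open import Data.Fin using (Fin; toℕ)
open import Data.Fin.Properties using (toℕ-fromℕ<; toℕ-injective; toℕ<n)
import Data.Fin.Properties as Fin
open import Data.Fin.Subset using (Subset; ⊥; ⁅_⁆; _∪_; _∩_; _∈_; _∉_; ∣_∣; inside; outside; Empty)
open import Data.Fin.Subset.Properties
  using (_∈?_; ⊆-antisym; x∈p∪q⁺; x∈p∪q⁻; x∈p∩q⁺; x∈p∩q⁻; x∈⁅x⁆; x∈⁅y⁆⇒x≡y; ∉⊥; ∣⊥∣≡0; ∣⁅x⁆∣≡1;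
         ∪-assoc; ∪-identityˡ; ∪-identityʳ; ∪-comm; ∩-comm; ∩-idem; Empty-unique)
open import Data.Vec using ([]; _∷_)
import Data.Vec.Properties as Vec
open import Data.List using (List; []; _∷_; _++_; map; filter; length; applyUpTo; concatMap)
open import Data.List.Properties
  using (filter-none; map-++; map-∘; map-cong; length-++; length-applyUpTo; ≡-dec)
import Data.List.Membership.Propositional as L
open import Data.List.Membership.Propositional using (find; lose) renaming (_∈_ to _∈ₗ_)
open import Data.List.Membership.Propositional.Properties
  using (∈-map⁺; ∈-map⁻; ∈-filter⁺; ∈-filter⁻; ∈-++⁺ˡ; ∈-++⁺ʳ; ∈-++⁻; ∈-applyUpTo⁺; ∈-applyUpTo⁻;
         ∈-concatMap⁺; ∈-concatMap⁻)
open import Data.List.Membership.DecPropositional _≟_ using () renaming (_∈?_ to _∈ₗ?_)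
open import Data.List.Relation.Unary.All as All using (All; []; _∷_)
import Data.List.Relation.Unary.All.Properties as All
open import Data.List.Relation.Unary.AllPairs as AllPairs using (AllPairs; []; _∷_; allPairs?)
import Data.List.Relation.Unary.AllPairs.Properties as AllPairs
open import Data.List.Relation.Unary.Any using (Any; here; there; any?)
open import Data.List.Relation.Unary.Unique.Propositional using (Unique)
open import Data.Product as Product using (Σ; ∃; ∃₂; _×_; _,_; proj₁; proj₂)
open import Data.Sum as Sum using (_⊎_; inj₁; inj₂; [_,_]′)
open import Data.Empty using (⊥-elim)
open import Relation.Nullary using (¬_; yes; no; Dec)
open import Relation.Nullary.Decidable using (_×-dec_; _⊎-dec_; from-yes)
open import Relation.Unary using (Decidable)
open import Function using (_∘_)
open import Relation.Binary.PropositionalEquality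
open ≡-Reasoning

∣p∪q∣+∣p∩q∣ : ∀ {n} (p q : Subset n) → ∣ p ∪ q ∣ + ∣ p ∩ q ∣ ≡ ∣ p ∣ + ∣ q ∣
∣p∪q∣+∣p∩q∣ [] [] = refl
∣p∪q∣+∣p∩q∣ (outside ∷ p) (outside ∷ q) = ∣p∪q∣+∣p∩q∣ p q
∣p∪q∣+∣p∩q∣ (inside ∷ p) (outside ∷ q) = cong suc (∣p∪q∣+∣p∩q∣ p q)
∣p∪q∣+∣p∩q∣ (outside ∷ p) (inside ∷ q) = trans (cong suc (∣p∪q∣+∣p∩q∣ p q)) (sym (+-suc ∣ p ∣ ∣ q ∣))
∣p∪q∣+∣p∩q∣ (inside ∷ p) (inside ∷ q) =
  trans (cong suc (trans (+-suc ∣ p ∪ q ∣ ∣ p ∩ q ∣) (cong suc (∣p∪q∣+∣p∩q∣ p q)))) (cong suc (sym (+-suc ∣ p ∣ ∣ q ∣)))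

∣p∪q∣≤∣p∣+∣q∣ : ∀ {n} (p q : Subset n) → ∣ p ∪ q ∣ ≤ ∣ p ∣ + ∣ q ∣
∣p∪q∣≤∣p∣+∣q∣ p q = subst (∣ p ∪ q ∣ ≤_) (∣p∪q∣+∣p∩q∣ p q) (m≤m+n _ _)

∣p∪q∣≡∣p∣+∣q∣ : ∀ {n} (p q : Subset n) → ∣ p ∩ q ∣ ≡ 0 → ∣ p ∪ q ∣ ≡ ∣ p ∣ + ∣ q ∣
∣p∪q∣≡∣p∣+∣q∣ p q disjoint =
  trans (sym (+-identityʳ _)) (trans (cong (∣ p ∪ q ∣ +_) (sym disjoint)) (∣p∪q∣+∣p∩q∣ p q))

allPairs-∈ : ∀ {A : Set} {R : A → A → Set} → (∀ {x y} → R x y → R y x) →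
             ∀ {xs x y} → AllPairs R xs → x ∈ₗ xs → y ∈ₗ xs → x ≢ y → R x y
allPairs-∈ symmetric (_ ∷ _) (here refl) (here refl) x≢y = ⊥-elim (x≢y refl)
allPairs-∈ symmetric (Rx ∷ _) (here refl) (there y∈) _ = All.lookup Rx y∈
allPairs-∈ symmetric (Ry ∷ _) (there x∈) (here refl) _ = symmetric (All.lookup Ry x∈)
allPairs-∈ symmetric (_ ∷ Rs) (there x∈) (there y∈) x≢y = allPairs-∈ symmetric Rs x∈ y∈ x≢y

-- Lists of positions

interval : ℕ → ℕ → List ℕ
interval a zero = []
interval a (suc k) = a ∷ interval (suc a) k

∈-interval⁺ : ∀ {a k x} → a ≤ x → x < a + k → x ∈ₗ interval a k
∈-interval⁺ {a} {zero} a≤x x<a+0 = ⊥-elim (<-irrefl refl (<-≤-trans (subst (_ <_) (+-identityʳ a) x<a+0) a≤x))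
∈-interval⁺ {a} {suc k} {x} a≤x x<a+1+k with m≤n⇒m<n∨m≡n a≤x
... | inj₂ refl = here refl
... | inj₁ a<x = there (∈-interval⁺ a<x (subst (x <_) (+-suc a k) x<a+1+k))

∈-interval⁻ : ∀ {a k x} → x ∈ₗ interval a k → a ≤ x × x < a + k
∈-interval⁻ {a} {suc k} (here refl) = ≤-refl , m<m+n a (s≤s z≤n)
∈-interval⁻ {a} {suc k} {x} (there x∈) with ∈-interval⁻ x∈
... | a<x , x<a+1+k = <⇒≤ a<x , subst (x <_) (sym (+-suc a k)) x<a+1+k

_⊕_ : ℕ → List ℕ → List ℕ
p ⊕ xs = map (p +_) xs

infixr 6 _⊕_

⊕-interval : ∀ p a k → p ⊕ interval a k ≡ interval (p + a) k
⊕-interval p a zero = refl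
⊕-interval p a (suc k) = cong (p + a ∷_) (trans (⊕-interval p (suc a) k) (cong (λ x → interval x k) (+-suc p a)))

⊕-⊕ : ∀ p q O → p ⊕ q ⊕ O ≡ (p + q) ⊕ O
⊕-⊕ p q O = trans (sym (map-∘ O)) (map-cong (λ x → sym (+-assoc p q x)) O)

All<-weaken : ∀ {k k′ xs} → k ≤ k′ → All (_< k) xs → All (_< k′) xs
All<-weaken k≤k′ = All.map (λ x<k → <-≤-trans x<k k≤k′)

⊕-All< : ∀ c {k xs} → All (_< k) xs → All (_< c + k) (c ⊕ xs)
⊕-All< c = All.map⁺ ∘ All.map (+-monoʳ-< c)

_∩ₗ_ : List ℕ → List ℕ → List ℕ
xs ∩ₗ ys = filter (_∈ₗ? ys) xs

data Adjacent : List ℕ → Set where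
  none : Adjacent []
  one  : ∀ x → Adjacent (x ∷ [])
  pair : ∀ x → Adjacent (x ∷ suc x ∷ [])

adjacent? : Decidable Adjacent
adjacent? [] = yes none
adjacent? (x ∷ []) = yes (one x)
adjacent? (x ∷ y ∷ []) with y ≟ suc x
... | yes refl = yes (pair x)
... | no y≢1+x = no λ { (pair _) → y≢1+x refl }
adjacent? (_ ∷ _ ∷ _ ∷ _) = no λ ()

∩ₗ-separated : ∀ {k xs ys} → All (_< k) xs → All (k ≤_) ys → xs ∩ₗ ys ≡ []
∩ₗ-separated xs<k k≤ys = filter-none (_∈ₗ? _) (All.map (λ x<k x∈ys → <⇒≱ x<k (All.lookup k≤ys x∈ys)) xs<k)

CompatibleIn : ℕ → List ℕ → List ℕ → Set
CompatibleIn k O O′ = All (_< k) O × All (_< k) O′ × Adjacent (O ∩ₗ O′)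

compatibleIn? : ∀ k O O′ → Dec (CompatibleIn k O O′)
compatibleIn? k O O′ = All.all? (_<? k) O ×-dec All.all? (_<? k) O′ ×-dec adjacent? (O ∩ₗ O′)

edge32 : ℕ × ℕ → List ℕ
edge32 (a , c) = interval a 3 ++ interval c 2

⊕-edge32 : ∀ p a c → p ⊕ edge32 (a , c) ≡ edge32 (p + a , p + c)
⊕-edge32 p a c = trans (map-++ (p +_) (interval a 3) (interval c 2)) (cong₂ _++_ (⊕-interval p a 3) (⊕-interval p c 2))

-- On a cycle of length k, the two blocks of edge32 (a , c) are separated by a gap on both sides.
Gapped : ℕ → ℕ × ℕ → Set
Gapped k (a , c) = (a + 3 < c × c + 2 < a + k) ⊎ (c + 2 < a × a + 3 < c + k)

gapped? : ∀ k → Decidable (Gapped k)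
gapped? k (a , c) = ((a + 3 <? c) ×-dec (c + 2 <? a + k)) ⊎-dec ((c + 2 <? a) ×-dec (a + 3 <? c + k))

Gapped-mono : ∀ {k k′} → k ≤ k′ → ∀ {s} → Gapped k s → Gapped k′ s
Gapped-mono k≤k′ {a , c} = Sum.map (Product.map₂ (λ lt → <-≤-trans lt (+-monoʳ-≤ a k≤k′)))
                                    (Product.map₂ (λ lt → <-≤-trans lt (+-monoʳ-≤ c k≤k′)))

Gapped-shift : ∀ p {k a c} → Gapped k (a , c) → Gapped k (p + a , p + c)
Gapped-shift p {k} {a} {c} = Sum.map (Product.map gap wrap) (Product.map gap wrap)
  where
  gap : ∀ {u v w} → u + v < w → p + u + v < p + w
  gap {u} {v} {w} lt = subst (_< p + w) (sym (+-assoc p u v)) (+-monoʳ-< p lt)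
  wrap : ∀ {u v w} → u + v < w + k → p + u + v < p + w + k
  wrap {u} {v} {w} lt = subst₂ _<_ (sym (+-assoc p u v)) (sym (+-assoc p w k)) (+-monoʳ-< p lt)

-- Positions on the cycle

module CyclePositions (N : ℕ) where

  n : ℕ
  n = suc N

  ι : ℕ → Fin n
  ι x = x mod n

  toℕ-ι : ∀ x → toℕ (ι x) ≡ x % n
  toℕ-ι x = toℕ-fromℕ< (m%n<n x n)

  ι-≡ : ∀ x y → x % n ≡ y % n → ι x ≡ ι y
  ι-≡ x y eq = toℕ-injective (trans (toℕ-ι x) (trans eq (sym (toℕ-ι y))))

  ι-toℕ : ∀ (i : Fin n) → ι (toℕ i) ≡ i
  ι-toℕ i = toℕ-injective (trans (toℕ-ι (toℕ i)) (m<n⇒m%n≡m (toℕ<n i)))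

  ι-+n : ∀ x → ι (x + n) ≡ ι x
  ι-+n x = ι-≡ (x + n) x ([m+n]%n≡m%n x n)

  %-absorbʳ : ∀ y x → (y + x % n) % n ≡ (y + x) % n
  %-absorbʳ y x = begin
    (y + x % n) % n           ≡⟨ %-distribˡ-+ y (x % n) n ⟩
    (y % n + x % n % n) % n   ≡⟨ cong (λ z → (y % n + z) % n) (m%n%n≡m%n x n) ⟩
    (y % n + x % n) % n       ≡⟨ %-distribˡ-+ y x n ⟨
    (y + x) % n               ∎

  next-ι : ∀ x → next (ι x) ≡ ι (suc x)
  next-ι x = ι-≡ (suc (toℕ (ι x))) (suc x) (trans (cong (λ z → (1 + z) % n) (toℕ-ι x)) (%-absorbʳ 1 x))

  prev-ι : ∀ x → prev (ι x) ≡ ι (x + N)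
  prev-ι x = ι-≡ (toℕ (ι x) + N) (x + N) (begin
    (toℕ (ι x) + N) % n   ≡⟨ cong (λ z → (z + N) % n) (toℕ-ι x) ⟩
    (x % n + N) % n       ≡⟨ cong (_% n) (+-comm (x % n) N) ⟩
    (N + x % n) % n       ≡⟨ %-absorbʳ N x ⟩
    (N + x) % n           ≡⟨ cong (_% n) (+-comm N x) ⟩
    (x + N) % n           ∎)

  prev-ι-suc : ∀ x → prev (ι (suc x)) ≡ ι x
  prev-ι-suc x = trans (prev-ι (suc x)) (trans (cong ι (sym (+-suc x N))) (ι-+n x))

  prev-ι-∸1 : ∀ {z} → 1 ≤ z → prev (ι z) ≡ ι (z ∸ 1)
  prev-ι-∸1 {z} 1≤z = trans (cong (λ w → prev (ι w)) (sym (m+[n∸m]≡n 1≤z))) (prev-ι-suc (z ∸ 1))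

  nextⁿ-ι : ∀ k x → nextⁿ k (ι x) ≡ ι (k + x)
  nextⁿ-ι zero x = refl
  nextⁿ-ι (suc k) x = trans (cong next (nextⁿ-ι k x)) (next-ι (k + x))

  -- Adding n ∸ p % n undoes the rotation by p, so ι is injective on every n consecutive positions.
  ι-injective : ∀ p {s t} → s < n → t < n → ι (p + s) ≡ ι (p + t) → s ≡ t
  ι-injective p {s} {t} s<n t<n eq = begin
    s                         ≡⟨ unrotate s<n ⟨
    (n ∸ r + (p + s) % n) % n ≡⟨ cong (λ z → (n ∸ r + z) % n) p+s≡p+t ⟩
    (n ∸ r + (p + t) % n) % n ≡⟨ unrotate t<n ⟩
    t                         ∎
    where
    r = p % n
    q = p / n
    p+s≡p+t : (p + s) % n ≡ (p + t) % n
    p+s≡p+t = trans (sym (toℕ-ι (p + s))) (trans (cong toℕ eq) (toℕ-ι (p + t)))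
    rearrange : ∀ a b c d → a + (b + c + d) ≡ d + (a + b) + c
    rearrange = solve-∀
    unrotate : ∀ {s} → s < n → (n ∸ r + (p + s) % n) % n ≡ s
    unrotate {s} s<n = begin
      (n ∸ r + (p + s) % n) % n    ≡⟨ %-absorbʳ (n ∸ r) (p + s) ⟩
      (n ∸ r + (p + s)) % n        ≡⟨ cong (λ z → (n ∸ r + (z + s)) % n) (m≡m%n+[m/n]*n p n) ⟩
      (n ∸ r + (r + q * n + s)) % n ≡⟨ cong (_% n) (rearrange (n ∸ r) r (q * n) s) ⟩
      (s + (n ∸ r + r) + q * n) % n ≡⟨ cong (λ z → (s + z + q * n) % n) (m∸n+n≡m (<⇒≤ (m%n<n p n))) ⟩
      (s + n + q * n) % n          ≡⟨ [m+kn]%n≡m%n (s + n) q n ⟩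
      (s + n) % n                  ≡⟨ [m+n]%n≡m%n s n ⟩
      s % n                        ≡⟨ m<n⇒m%n≡m s<n ⟩
      s                            ∎

  ι-injective′ : ∀ {p x y} → p ≤ x → x < p + n → p ≤ y → y < p + n → ι x ≡ ι y → x ≡ y
  ι-injective′ {p} {x} {y} p≤x x<p+n p≤y y<p+n eq =
    trans (sym (m+[n∸m]≡n p≤x))
      (trans (cong (p +_) (ι-injective p (offset p≤x x<p+n) (offset p≤y y<p+n)
                (trans (cong ι (m+[n∸m]≡n p≤x)) (trans eq (cong ι (sym (m+[n∸m]≡n p≤y)))))))
        (m+[n∸m]≡n p≤y))
    where
    offset : ∀ {z} → p ≤ z → z < p + n → z ∸ p < n
    offset {z} p≤z z<p+n = +-cancelˡ-< p (z ∸ p) n (subst (_< p + n) (sym (m+[n∸m]≡n p≤z)) z<p+n)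

  ⟦_⟧ : List ℕ → Subset n
  ⟦ [] ⟧ = ⊥
  ⟦ x ∷ xs ⟧ = ⁅ ι x ⁆ ∪ ⟦ xs ⟧

  ∈⟦⟧⁺ : ∀ {x xs} → x ∈ₗ xs → ι x ∈ ⟦ xs ⟧
  ∈⟦⟧⁺ {x} (here refl) = x∈p∪q⁺ (inj₁ (x∈⁅x⁆ (ι x)))
  ∈⟦⟧⁺ (there x∈) = x∈p∪q⁺ (inj₂ (∈⟦⟧⁺ x∈))

  ∈⟦⟧⁻ : ∀ {i} xs → i ∈ ⟦ xs ⟧ → ∃ λ x → x ∈ₗ xs × i ≡ ι x
  ∈⟦⟧⁻ [] i∈ = ⊥-elim (∉⊥ i∈)
  ∈⟦⟧⁻ (x ∷ xs) i∈ with x∈p∪q⁻ ⁅ ι x ⁆ ⟦ xs ⟧ i∈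
  ... | inj₁ i∈⁅x⁆ = x , here refl , x∈⁅y⁆⇒x≡y (ι x) i∈⁅x⁆
  ... | inj₂ i∈xs = let y , y∈ , eq = ∈⟦⟧⁻ xs i∈xs in y , there y∈ , eq

  ⟦++⟧ : ∀ xs ys → ⟦ xs ++ ys ⟧ ≡ ⟦ xs ⟧ ∪ ⟦ ys ⟧
  ⟦++⟧ [] ys = sym (∪-identityˡ ⟦ ys ⟧)
  ⟦++⟧ (x ∷ xs) ys = trans (cong (⁅ ι x ⁆ ∪_) (⟦++⟧ xs ys)) (sym (∪-assoc ⁅ ι x ⁆ ⟦ xs ⟧ ⟦ ys ⟧))

  ⟦map⟧-cong : ∀ {f g : ℕ → ℕ} → (∀ x → ι (f x) ≡ ι (g x)) → ∀ xs → ⟦ map f xs ⟧ ≡ ⟦ map g xs ⟧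
  ⟦map⟧-cong f≈g [] = refl
  ⟦map⟧-cong f≈g (x ∷ xs) = cong₂ (λ i p → ⁅ i ⁆ ∪ p) (f≈g x) (⟦map⟧-cong f≈g xs)

  ⟦⊕⟧-+n : ∀ p O → ⟦ (p + n) ⊕ O ⟧ ≡ ⟦ p ⊕ O ⟧
  ⟦⊕⟧-+n p = ⟦map⟧-cong λ x →
    trans (cong ι (trans (+-assoc p n x) (trans (cong (p +_) (+-comm n x)) (sym (+-assoc p x n))))) (ι-+n (p + x))

  seg-ι : ∀ a k → seg (ι a) k ≡ ⟦ interval a k ⟧
  seg-ι a zero = refl
  seg-ι a (suc k) = cong (⁅ ι a ⁆ ∪_) (trans (cong (λ i → seg i k) (next-ι a)) (seg-ι (suc a) k))

  cycEdge-ι : ∀ x → cycEdge (ι x) ≡ ⟦ x ∷ suc x ∷ [] ⟧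
  cycEdge-ι x = cong (⁅ ι x ⁆ ∪_) (trans (cong ⁅_⁆ (next-ι x)) (sym (∪-identityʳ ⁅ ι (suc x) ⁆)))

  ⟦⊕⟧-adjacent : ∀ p x → ⟦ p ⊕ (x ∷ suc x ∷ []) ⟧ ≡ cycEdge (ι (p + x))
  ⟦⊕⟧-adjacent p x = trans (cong (λ y → ⟦ p + x ∷ y ∷ [] ⟧) (+-suc p x)) (sym (cycEdge-ι (p + x)))

  ∈⟦⊕⟧⁻ : ∀ p {s O} → s < n → All (_< n) O → ι (p + s) ∈ ⟦ p ⊕ O ⟧ → s ∈ₗ O
  ∈⟦⊕⟧⁻ p {s} {O} s<n O<n s∈ with ∈⟦⟧⁻ (p ⊕ O) s∈
  ... | x , x∈ , eq with ∈-map⁻ (p +_) x∈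
  ... | t , t∈O , refl = subst (_∈ₗ O) (sym (ι-injective p s<n (All.lookup O<n t∈O) eq)) t∈O

  ∈⟦interval⟧⁻ : ∀ {p z a k} → p ≤ z → z < p + n → p ≤ a → a + k ≤ p + n →
                 ι z ∈ ⟦ interval a k ⟧ → a ≤ z × z < a + k
  ∈⟦interval⟧⁻ {a = a} {k} p≤z z<p+n p≤a a+k≤p+n z∈ with ∈⟦⟧⁻ (interval a k) z∈
  ... | y , y∈ , eq with ∈-interval⁻ y∈
  ... | a≤y , y<a+k =
    subst (λ w → a ≤ w × w < a + k)
      (sym (ι-injective′ p≤z z<p+n (≤-trans p≤a a≤y) (<-≤-trans y<a+k a+k≤p+n) eq)) (a≤y , y<a+k)

  ∈seg⁻ : ∀ {p z a k} → p ≤ z → z < p + n → p ≤ a → a + k ≤ p + n → ι z ∈ seg (ι a) k → a ≤ z × z < a + k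
  ∈seg⁻ {z = z} {a} {k} p≤z z<p+n p≤a a+k≤p+n z∈ =
    ∈⟦interval⟧⁻ p≤z z<p+n p≤a a+k≤p+n (subst (ι z ∈_) (seg-ι a k) z∈)

  ⟦⊕⟧-∩ : ∀ p {O O′} → All (_< n) O → All (_< n) O′ → ⟦ p ⊕ O ⟧ ∩ ⟦ p ⊕ O′ ⟧ ≡ ⟦ p ⊕ (O ∩ₗ O′) ⟧
  ⟦⊕⟧-∩ p {O} {O′} O<n O′<n = ⊆-antisym ⊆ ⊇
    where
    ⊆ : ∀ {i} → i ∈ ⟦ p ⊕ O ⟧ ∩ ⟦ p ⊕ O′ ⟧ → i ∈ ⟦ p ⊕ (O ∩ₗ O′) ⟧
    ⊆ i∈ with x∈p∩q⁻ ⟦ p ⊕ O ⟧ ⟦ p ⊕ O′ ⟧ i∈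
    ... | i∈O , i∈O′ with ∈⟦⟧⁻ (p ⊕ O) i∈O
    ... | x , x∈ , refl with ∈-map⁻ (p +_) x∈
    ... | s , s∈O , refl =
      ∈⟦⟧⁺ (∈-map⁺ (p +_) (∈-filter⁺ (_∈ₗ? O′) s∈O (∈⟦⊕⟧⁻ p (All.lookup O<n s∈O) O′<n i∈O′)))
    ⊇ : ∀ {i} → i ∈ ⟦ p ⊕ (O ∩ₗ O′) ⟧ → i ∈ ⟦ p ⊕ O ⟧ ∩ ⟦ p ⊕ O′ ⟧
    ⊇ i∈ with ∈⟦⟧⁻ (p ⊕ (O ∩ₗ O′)) i∈
    ... | x , x∈ , refl with ∈-map⁻ (p +_) x∈
    ... | s , s∈ , refl with ∈-filter⁻ (_∈ₗ? O′) {xs = O} s∈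
    ... | s∈O , s∈O′ = x∈p∩q⁺ (∈⟦⟧⁺ (∈-map⁺ (p +_) s∈O) , ∈⟦⟧⁺ (∈-map⁺ (p +_) s∈O′))

  ∣⟦⟧∣≤length : ∀ xs → ∣ ⟦ xs ⟧ ∣ ≤ length xs
  ∣⟦⟧∣≤length [] = ≤-reflexive (∣⊥∣≡0 n)
  ∣⟦⟧∣≤length (x ∷ xs) = ≤-trans (∣p∪q∣≤∣p∣+∣q∣ ⁅ ι x ⁆ ⟦ xs ⟧)
    (subst (λ c → c + ∣ ⟦ xs ⟧ ∣ ≤ suc (length xs)) (sym (∣⁅x⁆∣≡1 (ι x))) (s≤s (∣⟦⟧∣≤length xs)))

  ∣Empty∣ : ∀ {p : Subset n} → Empty p → ∣ p ∣ ≡ 0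
  ∣Empty∣ empty = trans (cong (∣_∣ {n = n}) (Empty-unique empty)) (∣⊥∣≡0 n)

  ∣⁅x⁆∪p∣ : ∀ x p → x ∉ p → ∣ ⁅ x ⁆ ∪ p ∣ ≡ suc ∣ p ∣
  ∣⁅x⁆∪p∣ x p x∉p = trans (∣p∪q∣≡∣p∣+∣q∣ ⁅ x ⁆ p (∣Empty∣ empty)) (cong (_+ ∣ p ∣) (∣⁅x⁆∣≡1 x))
    where
    empty : Empty (⁅ x ⁆ ∩ p)
    empty (y , y∈) with x∈p∩q⁻ ⁅ x ⁆ p y∈
    ... | y∈⁅x⁆ , y∈p = x∉p (subst (_∈ p) (x∈⁅y⁆⇒x≡y x y∈⁅x⁆) y∈p)

  ∣seg∣ : ∀ k (i : Fin n) → k ≤ n → ∣ seg i k ∣ ≡ k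
  ∣seg∣ zero i _ = ∣⊥∣≡0 n
  ∣seg∣ (suc k) i k<n = trans (∣⁅x⁆∪p∣ i (seg (next i) k) (subst (λ j → j ∉ seg (next j) k) (ι-toℕ i) (ι∉ (toℕ i))))
                              (cong suc (∣seg∣ k (next i) (<⇒≤ k<n)))
    where
    ι∉ : ∀ t → ι t ∉ seg (next (ι t)) k
    ι∉ t t∈ = <-irrefl refl (proj₁ (∈seg⁻ ≤-refl (m<m+n t (s≤s z≤n)) (n≤1+n t) (+-monoʳ-< t k<n)
                                          (subst (λ j → ι t ∈ seg j k) (next-ι t) t∈)))

  ∣cycEdge∣≤2 : ∀ (i : Fin n) → ∣ cycEdge i ∣ ≤ 2
  ∣cycEdge∣≤2 i = ≤-trans (∣p∪q∣≤∣p∣+∣q∣ ⁅ i ⁆ ⁅ next i ⁆) (≤-reflexive (cong₂ _+_ (∣⁅x⁆∣≡1 i) (∣⁅x⁆∣≡1 (next i))))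

  ∣cycEdge∣ : 2 ≤ n → ∀ (i : Fin n) → ∣ cycEdge i ∣ ≡ 2
  ∣cycEdge∣ 2≤n i = trans (cong (λ p → ∣ ⁅ i ⁆ ∪ p ∣) (sym (∪-identityʳ ⁅ next i ⁆))) (∣seg∣ 2 i 2≤n)

  SmallOrCycleEdge : Subset n → Set
  SmallOrCycleEdge X = ∣ X ∣ ≤ 1 ⊎ ∃ λ i → X ≡ cycEdge i

  Compatible : Subset n → Subset n → Set
  Compatible e f = SmallOrCycleEdge (e ∩ f)

  compatible-sym : ∀ {e f} → Compatible e f → Compatible f e
  compatible-sym {e} {f} = subst SmallOrCycleEdge (∩-comm e f)

  ⟦⊕⟧-compatible : ∀ p {O O′} → All (_< n) O → All (_< n) O′ → Adjacent (O ∩ₗ O′) →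
                   Compatible ⟦ p ⊕ O ⟧ ⟦ p ⊕ O′ ⟧
  ⟦⊕⟧-compatible p O<n O′<n adj = subst SmallOrCycleEdge (sym (⟦⊕⟧-∩ p O<n O′<n)) (small adj)
    where
    small : ∀ {I} → Adjacent I → SmallOrCycleEdge ⟦ p ⊕ I ⟧
    small none = inj₁ (≤-trans (∣⟦⟧∣≤length []) z≤n)
    small (one x) = inj₁ (∣⟦⟧∣≤length (p + x ∷ []))
    small (pair x) = inj₂ (ι (p + x) , ⟦⊕⟧-adjacent p x)

  ⟦⊕⟧-separated : ∀ p {k O O′} → All (_< k) O → All (k ≤_) O′ → All (_< n) O → All (_< n) O′ →
                  Compatible ⟦ p ⊕ O ⟧ ⟦ p ⊕ O′ ⟧
  ⟦⊕⟧-separated p O<k k≤O′ O<n O′<n = ⟦⊕⟧-compatible p O<n O′<n (subst Adjacent (sym (∩ₗ-separated O<k k≤O′)) none)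

  ⟦⊕⟧-compatibleIn : ∀ p {k O O′} → k ≤ n → CompatibleIn k O O′ → Compatible ⟦ p ⊕ O ⟧ ⟦ p ⊕ O′ ⟧
  ⟦⊕⟧-compatibleIn p k≤n (O<k , O′<k , adj) = ⟦⊕⟧-compatible p (All<-weaken k≤n O<k) (All<-weaken k≤n O′<k) adj

  compatible? : ∀ e f → Dec (Compatible e f)
  compatible? e f = (∣ e ∩ f ∣ ≤? 1) ⊎-dec Fin.any? (λ i → Vec.≡-dec Bool._≟_ (e ∩ f) (cycEdge i))

  compatible⇒≢ : ∀ {e f} → ∣ e ∣ ≡ 5 → Compatible e f → e ≢ f
  compatible⇒≢ {e} ∣e∣≡5 compatible refl = [ small , edge ]′ (subst SmallOrCycleEdge (∩-idem e) compatible)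
    where
    small : ¬ ∣ e ∣ ≤ 1
    small ∣e∣≤1 with subst (_≤ 1) ∣e∣≡5 ∣e∣≤1
    ... | s≤s ()
    edge : ¬ ∃ λ i → e ≡ cycEdge i
    edge (i , e≡) with subst (_≤ 2) (trans (cong ∣_∣ (sym e≡)) ∣e∣≡5) (∣cycEdge∣≤2 i)
    ... | s≤s (s≤s ())

  compatible⇒unique : ∀ {E} → All (λ e → ∣ e ∣ ≡ 5) E → AllPairs Compatible E → Unique E
  compatible⇒unique [] [] = []
  compatible⇒unique (∣e∣≡5 ∷ sizes) (compatibles ∷ pairs) =
    All.map (compatible⇒≢ ∣e∣≡5) compatibles ∷ compatible⇒unique sizes pairs

  seg-section : ∀ {a k} → k < n → IsSection (seg (ι a) k) (ι a) k
  seg-section {a} {k} k<n = (λ i∈ → i∈) , prev∉ , next∉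
    where
    in-seg : ∀ {z} → a ≤ z → z < a + n → ι z ∈ seg (ι a) k → z < a + k
    in-seg a≤z z<a+n z∈ = proj₂ (∈seg⁻ a≤z z<a+n ≤-refl (+-monoʳ-≤ a (<⇒≤ k<n)) z∈)
    prev∉ : prev (ι a) ∉ seg (ι a) k
    prev∉ z∈ = <⇒≱ (in-seg (m≤m+n a N) (+-monoʳ-< a ≤-refl) (subst (_∈ seg (ι a) k) (prev-ι a) z∈))
                    (+-monoʳ-≤ a (≤-pred k<n))
    next∉ : nextⁿ k (ι a) ∉ seg (ι a) k
    next∉ z∈ = <-irrefl (+-comm k a)
                 (in-seg (m≤n+m a k) (subst (_< a + n) (+-comm a k) (+-monoʳ-< a k<n))
                    (subst (_∈ seg (ι a) k) (nextⁿ-ι k a) z∈))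

  edge32-blocks : ∀ a c → ⟦ edge32 (a , c) ⟧ ≡ seg (ι a) 3 ∪ seg (ι c) 2
  edge32-blocks a c = trans (⟦++⟧ (interval a 3) (interval c 2)) (sym (cong₂ _∪_ (seg-ι a 3) (seg-ι c 2)))

  -- Both blocks lie in the window [x, x + n), where positions are faithful.
  ∉-two-blocks : ∀ {x k y l z} → x ≤ y → y + l ≤ x + n → x ≤ z → z < x + n → x + k ≤ z → z < y ⊎ y + l ≤ z →
                 ι z ∉ seg (ι x) k ∪ seg (ι y) l
  ∉-two-blocks {x} {k} {y} {l} {z} x≤y y+l≤x+n x≤z z<x+n x+k≤z z∉B z∈ = [ ∉A , ∉B ]′ (x∈p∪q⁻ _ _ z∈)
    where
    ∉A : ¬ ι z ∈ seg (ι x) k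
    ∉A z∈A = <⇒≱ (proj₂ (∈seg⁻ x≤z z<x+n ≤-refl (<⇒≤ (≤-<-trans x+k≤z z<x+n)) z∈A)) x+k≤z
    ∉B : ¬ ι z ∈ seg (ι y) l
    ∉B z∈B with ∈seg⁻ x≤z z<x+n x≤y y+l≤x+n z∈B
    ... | y≤z , z<y+l = [ (λ z<y → <⇒≱ z<y y≤z) , (λ y+l≤z → <⇒≱ z<y+l y+l≤z) ]′ z∉B

  two-blocks-disjoint : ∀ {x k y l} → x + k ≤ y → y + l ≤ x + n → ∣ seg (ι x) k ∩ seg (ι y) l ∣ ≡ 0
  two-blocks-disjoint {x} {k} {y} {l} x+k≤y y+l≤x+n = ∣Empty∣ λ (i , i∈) → disjoint (x∈p∩q⁻ _ _ i∈)
    where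
    disjoint : ∀ {i} → ¬ (i ∈ seg (ι x) k × i ∈ seg (ι y) l)
    disjoint {i} (i∈A , i∈B) with ∈⟦⟧⁻ (interval x k) (subst (i ∈_) (seg-ι x k) i∈A)
    ... | z , z∈ , refl with ∈-interval⁻ z∈
    ... | x≤z , z<x+k =
      <⇒≱ (<-≤-trans z<x+k x+k≤y)
          (proj₁ (∈seg⁻ x≤z (<-≤-trans z<x+k (≤-trans x+k≤y (≤-trans (m≤m+n y l) y+l≤x+n)))
                        (≤-trans (m≤m+n x k) x+k≤y) y+l≤x+n i∈B))

  two-blocks : ∀ {x k y l} → x + k < y → y + l < x + n →
    let e = seg (ι x) k ∪ seg (ι y) l in
    IsSection e (ι x) k × IsSection e (ι y) l × ∣ seg (ι x) k ∩ seg (ι y) l ∣ ≡ 0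
  two-blocks {x} {k} {y} {l} x+k<y y+l<x+n =
    ((λ i∈ → x∈p∪q⁺ (inj₁ i∈)) , prevA∉ , nextA∉) , ((λ i∈ → x∈p∪q⁺ (inj₂ i∈)) , prevB∉ , nextB∉) ,
    two-blocks-disjoint (<⇒≤ x+k<y) (<⇒≤ y+l<x+n)
    where
    E = seg (ι x) k ∪ seg (ι y) l
    x≤y = ≤-trans (m≤m+n x k) (<⇒≤ x+k<y)
    y≤y+l = m≤m+n y l
    y+l≤x+N : y + l ≤ x + N
    y+l≤x+N = ≤-pred (subst (y + l <_) (+-suc x N) y+l<x+n)
    x+k≤x+N : x + k ≤ x + N
    x+k≤x+N = ≤-trans (<⇒≤ x+k<y) (≤-trans y≤y+l y+l≤x+N)
    off-blocks : ∀ {z} → x ≤ z → z < x + n → x + k ≤ z → z < y ⊎ y + l ≤ z → ι z ∉ E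
    off-blocks = ∉-two-blocks x≤y (<⇒≤ y+l<x+n)
    prevA∉ : prev (ι x) ∉ E
    prevA∉ = subst (_∉ E) (sym (prev-ι x))
               (off-blocks (m≤m+n x N) (+-monoʳ-< x ≤-refl) x+k≤x+N (inj₂ y+l≤x+N))
    nextA∉ : nextⁿ k (ι x) ∉ E
    nextA∉ = subst (_∉ E) (sym (trans (nextⁿ-ι k x) (cong ι (+-comm k x))))
               (off-blocks (m≤m+n x k) (≤-trans x+k<y (≤-trans y≤y+l (<⇒≤ y+l<x+n))) ≤-refl (inj₁ x+k<y))
    1≤y = ≤-trans (s≤s z≤n) x+k<y
    y∸1<y : y ∸ 1 < y
    y∸1<y = ≤-reflexive (m+[n∸m]≡n 1≤y)
    prevB∉ : prev (ι y) ∉ E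
    prevB∉ = subst (_∉ E) (sym (prev-ι-∸1 1≤y))
               (off-blocks (≤-trans (m≤m+n x k) (∸-monoˡ-≤ 1 x+k<y)) (<-trans y∸1<y (≤-<-trans y≤y+l y+l<x+n))
                           (∸-monoˡ-≤ 1 x+k<y) (inj₁ y∸1<y))
    nextB∉ : nextⁿ l (ι y) ∉ E
    nextB∉ = subst (_∉ E) (sym (trans (nextⁿ-ι l y) (cong ι (+-comm l y))))
               (off-blocks (≤-trans x≤y y≤y+l) y+l<x+n (≤-trans (<⇒≤ x+k<y) y≤y+l) (inj₂ ≤-refl))

  sections⇒Is32 : ∀ {e} a c → e ≡ seg (ι a) 3 ∪ seg (ι c) 2 →
    IsSection (seg (ι a) 3 ∪ seg (ι c) 2) (ι a) 3 → IsSection (seg (ι a) 3 ∪ seg (ι c) 2) (ι c) 2 →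
    ∣ seg (ι a) 3 ∩ seg (ι c) 2 ∣ ≡ 0 → Is32Edge e
  sections⇒Is32 a c refl sa sc disjoint = ι a , ι c , sa , sc , disjoint , refl

  edge32-is32 : ∀ {s} → Gapped n s → Is32Edge ⟦ edge32 s ⟧
  edge32-is32 {a , c} (inj₁ (a+3<c , c+2<a+n)) =
    let sa , sc , disjoint = two-blocks a+3<c c+2<a+n in sections⇒Is32 a c (edge32-blocks a c) sa sc disjoint
  edge32-is32 {a , c} (inj₂ (c+2<a , a+3<c+n)) =
    let sc , sa , disjoint = two-blocks c+2<a a+3<c+n
        swap = ∪-comm (seg (ι c) 2) (seg (ι a) 3)
    in sections⇒Is32 a c (edge32-blocks a c) (subst (λ e → IsSection e (ι a) 3) swap sa)
         (subst (λ e → IsSection e (ι c) 2) swap sc) (trans (cong ∣_∣ (∩-comm (seg (ι a) 3) (seg (ι c) 2))) disjoint)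

  block-is5 : ∀ a → 5 < n → Is5Edge ⟦ interval a 5 ⟧
  block-is5 a 5<n = ι a , subst (λ e → IsSection e (ι a) 5) (seg-ι a 5) (seg-section {a} 5<n) , sym (seg-ι a 5)

  -- A section inside a single block of five either starts at the block's start, and then runs on
  -- past three vertices, or it starts later, and then its predecessor is in the block.
  ¬5∧32 : ∀ {e} → Is5Edge e → ¬ Is32Edge e
  ¬5∧32 {e} (i , _ , e≡seg) (a , _ , (seg⊆e , prev∉ , next∉) , _) =
    [ (λ t<z → prev∉ (prev∈ t<z)) , (λ t≡z → next∉ (next∈ t≡z)) ]′ (m≤n⇒m<n∨m≡n t≤z)
    where
    t = toℕ i
    block : e ≡ ⟦ interval t 5 ⟧
    block = trans e≡seg (trans (cong (λ j → seg j 5) (sym (ι-toℕ i))) (seg-ι t 5))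
    a∈ : ∃ λ z → z ∈ₗ interval t 5 × a ≡ ι z
    a∈ = ∈⟦⟧⁻ (interval t 5) (subst (a ∈_) block (seg⊆e (x∈p∪q⁺ (inj₁ (x∈⁅x⁆ a)))))
    z = proj₁ a∈
    a≡ιz = proj₂ (proj₂ a∈)
    t≤z = proj₁ (∈-interval⁻ (proj₁ (proj₂ a∈)))
    z<t+5 = proj₂ (∈-interval⁻ (proj₁ (proj₂ a∈)))
    in-block : ∀ {w} → t ≤ w → w < t + 5 → ι w ∈ e
    in-block t≤w w<t+5 = subst (_ ∈_) (sym block) (∈⟦⟧⁺ (∈-interval⁺ t≤w w<t+5))
    prev∈ : t < z → prev a ∈ e
    prev∈ t<z = subst (_∈ e) (sym (trans (cong prev a≡ιz) (prev-ι-∸1 (≤-trans (s≤s z≤n) t<z))))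
                  (in-block (∸-monoˡ-≤ 1 t<z) (≤-<-trans (m∸n≤m z 1) z<t+5))
    next∈ : t ≡ z → nextⁿ 3 a ∈ e
    next∈ t≡z = subst (_∈ e) (sym (trans (cong (nextⁿ 3) a≡ιz) (nextⁿ-ι 3 z)))
                  (in-block (≤-trans t≤z (m≤n+m z 3)) (subst (λ w → 3 + w < t + 5) t≡z 3+t<t+5))
      where
      3+t<t+5 : 3 + t < t + 5
      3+t<t+5 = subst (_< t + 5) (+-comm t 3) (+-monoʳ-< t (s≤s (s≤s (s≤s (s≤s z≤n)))))

  ∣5-edge∣ : 5 ≤ n → ∀ {e} → Is5Edge e → ∣ e ∣ ≡ 5
  ∣5-edge∣ 5≤n (i , _ , e≡) = trans (cong ∣_∣ e≡) (∣seg∣ 5 i 5≤n)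

  ∣32-edge∣ : 3 ≤ n → ∀ {e} → Is32Edge e → ∣ e ∣ ≡ 5
  ∣32-edge∣ 3≤n (i , j , _ , _ , disjoint , e≡) =
    trans (cong ∣_∣ e≡) (trans (∣p∪q∣≡∣p∣+∣q∣ (seg i 3) (seg j 2) disjoint)
                               (cong₂ _+_ (∣seg∣ 3 i 3≤n) (∣seg∣ 2 j (≤-trans (n≤1+n 2) 3≤n))))

  Covers : List (Subset n) → Set
  Covers E = ∀ i → ∃₂ λ e f → e ∈ₗ E × f ∈ₗ E × e ∩ f ≡ cycEdge i

  CoveredBy : List (Subset n) → Fin n → Set
  CoveredBy E i = Any (λ e → i ∈ e × Any (λ f → e ∩ f ≡ cycEdge i) E) E

  -- The test i ∈ e is implied by the rest; it only prunes the search.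
  coveredBy? : ∀ E i → Dec (CoveredBy E i)
  coveredBy? E i = any? (λ e → (i ∈? e) ×-dec any? (λ f → Vec.≡-dec Bool._≟_ (e ∩ f) (cycEdge i)) E) E

  coveredBy⇒covers : ∀ {E} → (∀ i → CoveredBy E i) → Covers E
  coveredBy⇒covers covered i =
    let e , e∈ , _ , f∈Any = find (covered i) ; f , f∈ , e∩f≡ = find f∈Any in e , f , e∈ , f∈ , e∩f≡

  EI-cycle : 2 ≤ n → ∀ {E} → All (λ e → ∣ e ∣ ≡ 5) E → AllPairs Compatible E → Covers E → EIisCycle E
  EI-cycle 2≤n {E} sizes pairs covers X = to , from
    where
    to : InEI E X → ∃ λ i → X ≡ cycEdge i
    to (e , f , e∈ , f∈ , e≢f , 2≤∣e∩f∣ , X≡) with allPairs-∈ compatible-sym pairs e∈ f∈ e≢f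
    ... | inj₁ ∣e∩f∣≤1 = ⊥-elim (<⇒≱ (s≤s ∣e∩f∣≤1) 2≤∣e∩f∣)
    ... | inj₂ (i , e∩f≡) = i , trans X≡ e∩f≡
    from : (∃ λ i → X ≡ cycEdge i) → InEI E X
    from (i , X≡) =
      let e , f , e∈ , f∈ , e∩f≡ = covers i
      in e , f , e∈ , f∈ , compatible⇒≢ (All.lookup sizes e∈) (inj₂ (i , e∩f≡)) ,
         ≤-reflexive (sym (trans (cong ∣_∣ e∩f≡) (∣cycEdge∣ 2≤n i))) , trans X≡ (sym e∩f≡)

  five-unique : ∀ {e₀ : Subset n} {es} → All Is32Edge es → ∀ e → e ∈ₗ e₀ ∷ es → Is5Edge e → e ≡ e₀
  five-unique _ e (here refl) _ = refl
  five-unique es-32 e (there e∈) e-5 = ⊥-elim (¬5∧32 e-5 (All.lookup es-32 e∈))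

  others-32 : ∀ {e₀ : Subset n} {es} → All Is32Edge es → ∀ e → e ∈ₗ e₀ ∷ es → e ≢ e₀ → Is32Edge e
  others-32 _ e (here refl) e≢e₀ = ⊥-elim (e≢e₀ refl)
  others-32 es-32 e (there e∈) _ = All.lookup es-32 e∈

-- The hypergraph

data Family : Set where
  X Y : Family

shape : Family → ℕ × ℕ
shape X = 9 , 2
shape Y = 1 , 6

-- The seam, in positions relative to m * 3.
seam32 : List (ℕ × ℕ)
seam32 = (10 , 15) ∷ (13 , 23) ∷ (19 , 11) ∷ (20 , 14) ∷ (23 , 17) ∷ (26 , 18) ∷ []

seam : List (List ℕ)
seam = interval 16 5 ∷ map edge32 seam32

module Hypergraph (m : ℕ) where

  open CyclePositions (19 + m * 3) public

  b : ℕ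
  b = m * 3

  K : ℕ
  K = m + 3

  member : Family → ℕ → Subset n
  member κ i = ⟦ i * 3 ⊕ edge32 (shape κ) ⟧

  members : Family → List (Subset n)
  members κ = applyUpTo (member κ) K

  hyperedges : List (Subset n)
  hyperedges = map (λ O → ⟦ b ⊕ O ⟧) seam ++ (members X ++ members Y)

  20≤n : 20 ≤ n
  20≤n = m≤m+n 20 (m * 3)

  anchored-is32 : ∀ p {s} → Gapped 20 s → Is32Edge ⟦ p ⊕ edge32 s ⟧
  anchored-is32 p {a , c} gaps =
    subst Is32Edge (cong ⟦_⟧ (sym (⊕-edge32 p a c))) (edge32-is32 (Gapped-shift p (Gapped-mono 20≤n gaps)))

  five-edge : Is5Edge ⟦ b ⊕ interval 16 5 ⟧
  five-edge = subst Is5Edge (cong ⟦_⟧ (sym (⊕-interval b 16 5))) (block-is5 (b + 16) (≤-trans (s≤s (m≤m+n 5 14)) 20≤n))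

  seam-family-32 : All Is32Edge (map (λ s → ⟦ b ⊕ edge32 s ⟧) seam32 ++ (members X ++ members Y))
  seam-family-32 = All.++⁺ (All.map⁺ (All.map (anchored-is32 b) (from-yes (All.all? (gapped? 20) seam32))))
                  (All.++⁺ (family-32 X) (family-32 Y))
    where
    family-32 : ∀ κ → All Is32Edge (members κ)
    family-32 X = All.applyUpTo⁺₂ (member X) K (λ i → anchored-is32 (i * 3) (from-yes (gapped? 20 (shape X))))
    family-32 Y = All.applyUpTo⁺₂ (member Y) K (λ i → anchored-is32 (i * 3) (from-yes (gapped? 20 (shape Y))))

  length-hyperedges : length hyperedges ≡ 2 * ((n ∸ 2) / 3) + 1
  length-hyperedges = begin
    length hyperedges                    ≡⟨ length-++ (map (λ O → ⟦ b ⊕ O ⟧) seam) {members X ++ members Y} ⟩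
    7 + length (members X ++ members Y)  ≡⟨ cong (7 +_) (length-++ (members X) {members Y}) ⟩
    7 + (length (members X) + length (members Y))
      ≡⟨ cong (7 +_) (cong₂ _+_ (length-applyUpTo (member X) K) (length-applyUpTo (member Y) K)) ⟩
    7 + (K + K)                          ≡⟨ count m ⟩
    2 * (6 + m) + 1                      ≡⟨ cong (λ q → 2 * q + 1) (m*n/n≡m (6 + m) 3) ⟨
    2 * ((n ∸ 2) / 3) + 1                ∎
    where
    count : ∀ m → 7 + ((m + 3) + (m + 3)) ≡ 2 * (6 + m) + 1
    count = solve-∀

-- Cycles of length at least 38

families : List Family
families = X ∷ Y ∷ []

family∈ : ∀ κ → κ ∈ₗ families
family∈ X = here refl
family∈ Y = there (here refl)

-- Family members near the seam, in positions relative to m * 3: as n = 20 + m * 3, member i < 3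
-- sits at 20 + i * 3 and member m + t at t * 3.
lowTag highTag : Family → ℕ → List ℕ
lowTag κ i = (20 + i * 3) ⊕ edge32 (shape κ)
highTag κ t = t * 3 ⊕ edge32 (shape κ)

familyTags : Family → List (List ℕ)
familyTags κ = applyUpTo (lowTag κ) 3 ++ applyUpTo (highTag κ) 3

tags : List (List ℕ)
tags = concatMap familyTags families

window : List (List ℕ)
window = seam ++ tags

lowTag∈ : ∀ κ {i} → i < 3 → lowTag κ i ∈ₗ tags
lowTag∈ κ i<3 = ∈-concatMap⁺ familyTags (lose (family∈ κ) (∈-++⁺ˡ (∈-applyUpTo⁺ (lowTag κ) i<3)))

highTag∈ : ∀ κ {t} → t < 3 → highTag κ t ∈ₗ tags
highTag∈ κ t<3 =
  ∈-concatMap⁺ familyTags (lose (family∈ κ) (∈-++⁺ʳ (applyUpTo (lowTag κ) 3) (∈-applyUpTo⁺ (highTag κ) t<3)))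

-- Evaluated once; abstract, so that their normal forms are never unfolded at the use sites.
abstract
  seam-compatible : AllPairs (CompatibleIn 38) seam
  seam-compatible = from-yes (allPairs? (compatibleIn? 38) seam)

  seam-tags-compatible : All (λ O → All (CompatibleIn 38 O) tags) seam
  seam-tags-compatible = from-yes (All.all? (λ O → All.all? (compatibleIn? 38 O) tags) seam)

  seam-range : All (All (λ o → 10 ≤ o × o < 29)) seam
  seam-range = from-yes (All.all? (All.all? (λ o → (10 ≤? o) ×-dec (o <? 29))) seam)

  window-bounded : All (All (_< 38)) window
  window-bounded = from-yes (All.all? (All.all? (_<? 38)) window)

  window-covers : All (λ s → Any (λ O → Any (λ O′ → O ∩ₗ O′ ≡ s ∷ suc s ∷ []) window) window) (interval 8 22)
  window-covers = from-yes (All.all? (λ s → any? (λ O → any? (λ O′ → ≡-dec _≟_ (O ∩ₗ O′) (s ∷ suc s ∷ []))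
                                                                 window) window) (interval 8 22))

  shape-bounded : ∀ κ → All (_< 12) (edge32 (shape κ))
  shape-bounded X = from-yes (All.all? (_<? 12) (edge32 (shape X)))
  shape-bounded Y = from-yes (All.all? (_<? 12) (edge32 (shape Y)))

  near-table : All (λ κ → All (λ κ′ → All (λ d → CompatibleIn 21 (edge32 (shape κ)) (d * 3 ⊕ edge32 (shape κ′)))
                                            (interval 1 3)) families) families
  near-table = from-yes (All.all? (λ κ → All.all? (λ κ′ → All.all? (λ d →
                 compatibleIn? 21 (edge32 (shape κ)) (d * 3 ⊕ edge32 (shape κ′))) (interval 1 3)) families) families)

near : ∀ κ κ′ d → d < 4 → 0 < d ⊎ κ ≢ κ′ → CompatibleIn 21 (edge32 (shape κ)) (d * 3 ⊕ edge32 (shape κ′))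
near κ κ′ zero _ (inj₁ ())
near X X zero _ (inj₂ X≢X) = ⊥-elim (X≢X refl)
near X Y zero _ _ = from-yes (compatibleIn? 21 (edge32 (shape X)) (0 ⊕ edge32 (shape Y)))
near Y X zero _ _ = from-yes (compatibleIn? 21 (edge32 (shape Y)) (0 ⊕ edge32 (shape X)))
near Y Y zero _ (inj₂ Y≢Y) = ⊥-elim (Y≢Y refl)
near κ κ′ (suc d) d<4 _ =
  All.lookup (All.lookup (All.lookup near-table (family∈ κ)) (family∈ κ′)) (∈-interval⁺ (s≤s z≤n) d<4)

data Residue3 : ℕ → Set where
  0+ : ∀ t → Residue3 (t * 3)
  1+ : ∀ t → Residue3 (1 + t * 3)
  2+ : ∀ t → Residue3 (2 + t * 3)

residue3 : ∀ x → Residue3 x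
residue3 0 = 0+ 0
residue3 1 = 1+ 0
residue3 2 = 2+ 0
residue3 (suc (suc (suc x))) with residue3 x
... | 0+ t = 0+ (suc t)
... | 1+ t = 1+ (suc t)
... | 2+ t = 2+ (suc t)

module LargeHypergraph (m : ℕ) (6≤m : 6 ≤ m) where

  open Hypergraph m

  38≤n : 38 ≤ n
  38≤n = +-monoʳ-≤ 20 (*-monoˡ-≤ 3 6≤m)

  21≤n : 21 ≤ n
  21≤n = ≤-trans (m≤m+n 21 17) 38≤n

  12≤n : 12 ≤ n
  12≤n = ≤-trans (m≤m+n 12 9) 21≤n

  member-shift : ∀ κ i d → ⟦ i * 3 ⊕ d * 3 ⊕ edge32 (shape κ) ⟧ ≡ member κ (i + d)
  member-shift κ i d =
    cong ⟦_⟧ (trans (⊕-⊕ (i * 3) (d * 3) (edge32 (shape κ))) (cong (_⊕ edge32 (shape κ)) (sym (*-distribʳ-+ 3 i d))))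

  lowTag≡ : ∀ κ i → ⟦ b ⊕ lowTag κ i ⟧ ≡ member κ i
  lowTag≡ κ i = trans (cong ⟦_⟧ (trans (⊕-⊕ b (20 + i * 3) O) (cong (_⊕ O) (wrap b (i * 3))))) (⟦⊕⟧-+n (i * 3) O)
    where
    O = edge32 (shape κ)
    wrap : ∀ b y → b + (20 + y) ≡ y + (20 + b)
    wrap = solve-∀

  highTag≡ : ∀ κ t → ⟦ b ⊕ highTag κ t ⟧ ≡ member κ (m + t)
  highTag≡ κ t =
    cong ⟦_⟧ (trans (⊕-⊕ b (t * 3) (edge32 (shape κ))) (cong (_⊕ edge32 (shape κ)) (sym (*-distribʳ-+ 3 m t))))

  members-compatible : ∀ {κ κ′ i j} → i ≤ j → j < K → i < j ⊎ κ ≢ κ′ → Compatible (member κ i) (member κ′ j)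
  members-compatible {κ} {κ′} {i} {j} i≤j j<K distinct =
    subst (Compatible (member κ i)) (trans (member-shift κ′ i d) (cong (member κ′) (m+[n∸m]≡n i≤j)))
      (by-distance (d <? 4))
    where
    d = j ∸ i
    O = edge32 (shape κ)
    O′ = edge32 (shape κ′)
    d*3+12≤n : d * 3 + 12 ≤ n
    d*3+12≤n = ≤-trans (+-monoˡ-≤ 12 (*-monoˡ-≤ 3 (≤-trans (m∸n≤m j i) (≤-pred (subst (j <_) (+-suc m 2) j<K)))))
                       (≤-trans (≤-reflexive (count m)) (+-monoˡ-≤ (m * 3) (m≤m+n 18 2)))
      where
      count : ∀ m → (m + 2) * 3 + 12 ≡ 18 + m * 3
      count = solve-∀
    by-distance : Dec (d < 4) → Compatible ⟦ i * 3 ⊕ O ⟧ ⟦ i * 3 ⊕ d * 3 ⊕ O′ ⟧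
    by-distance (yes d<4) = ⟦⊕⟧-compatibleIn (i * 3) 21≤n (near κ κ′ d d<4 (Sum.map₁ m<n⇒0<n∸m distinct))
    by-distance (no d≮4) =
      ⟦⊕⟧-separated (i * 3) (shape-bounded κ)
        (All.map⁺ (All.tabulate (λ {x} _ → ≤-trans (*-monoˡ-≤ 3 (≮⇒≥ d≮4)) (m≤m+n (d * 3) x))))
        (All<-weaken 12≤n (shape-bounded κ)) (All<-weaken d*3+12≤n (⊕-All< (d * 3) (shape-bounded κ′)))

  window-compatible : ∀ {O T} → O ∈ₗ seam → T ∈ₗ tags → Compatible ⟦ b ⊕ O ⟧ ⟦ b ⊕ T ⟧
  window-compatible O∈ T∈ = ⟦⊕⟧-compatibleIn b 38≤n (All.lookup (All.lookup seam-tags-compatible O∈) T∈)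

  -- Seen from member i, the seam starts at least 13 positions later and ends before n positions.
  member-seam-apart : ∀ κ {i O} → 3 ≤ i → i < m → O ∈ₗ seam → Compatible (member κ i) ⟦ b ⊕ O ⟧
  member-seam-apart κ {i} {O} 3≤i i<m O∈ =
    subst (Compatible (member κ i)) (cong ⟦_⟧ (trans (⊕-⊕ (i * 3) (d * 3) O) (cong (_⊕ O) i*3+d*3≡b)))
      (⟦⊕⟧-separated (i * 3) (shape-bounded κ)
         (All.map⁺ (All.map (λ (10≤o , _) → ≤-trans (m≤m+n 12 1) (+-mono-≤ (*-monoˡ-≤ 3 1≤d) 10≤o)) range))
         (All<-weaken 12≤n (shape-bounded κ))
         (All.map⁺ (All.map (λ (_ , o<29) → <-≤-trans (+-monoʳ-< (d * 3) (<-≤-trans o<29 29≤20+i*3)) d*3+[20+i*3]≤n)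
                            range)))
    where
    d = m ∸ i
    range = All.lookup seam-range O∈
    1≤d : 1 ≤ d
    1≤d = m<n⇒0<n∸m i<m
    i*3+d*3≡b : i * 3 + d * 3 ≡ b
    i*3+d*3≡b = trans (sym (*-distribʳ-+ 3 i d)) (cong (_* 3) (m+[n∸m]≡n (<⇒≤ i<m)))
    29≤20+i*3 : 29 ≤ 20 + i * 3
    29≤20+i*3 = +-monoʳ-≤ 20 (*-monoˡ-≤ 3 3≤i)
    d*3+[20+i*3]≤n : d * 3 + (20 + i * 3) ≤ n
    d*3+[20+i*3]≤n = ≤-reflexive (trans (rearrange (d * 3) (i * 3)) (cong (20 +_) i*3+d*3≡b))
      where
      rearrange : ∀ a c → a + (20 + c) ≡ 20 + (c + a)
      rearrange = solve-∀

  seam-member : ∀ {O} → O ∈ₗ seam → ∀ κ {i} → i < K → Compatible ⟦ b ⊕ O ⟧ (member κ i)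
  seam-member {O} O∈ κ {i} i<K with i <? 3 | m ≤? i
  ... | yes i<3 | _ = subst (Compatible ⟦ b ⊕ O ⟧) (lowTag≡ κ i) (window-compatible O∈ (lowTag∈ κ i<3))
  ... | no _ | yes m≤i =
    subst (Compatible ⟦ b ⊕ O ⟧) (trans (highTag≡ κ (i ∸ m)) (cong (member κ) (m+[n∸m]≡n m≤i)))
      (window-compatible O∈ (highTag∈ κ (+-cancelˡ-< m (i ∸ m) 3 (subst (_< m + 3) (sym (m+[n∸m]≡n m≤i)) i<K))))
  ... | no i≮3 | no m≰i = compatible-sym (member-seam-apart κ (≮⇒≥ i≮3) (≰⇒> m≰i) O∈)

  hyperedges-compatible : AllPairs Compatible hyperedges
  hyperedges-compatible = AllPairs.++⁺ seam-pairs (AllPairs.++⁺ (members-pairs X) (members-pairs Y) X-Y) seam-members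
    where
    seam-pairs : AllPairs Compatible (map (λ O → ⟦ b ⊕ O ⟧) seam)
    seam-pairs = AllPairs.map⁺ (AllPairs.map (⟦⊕⟧-compatibleIn b 38≤n) seam-compatible)
    members-pairs : ∀ κ → AllPairs Compatible (members κ)
    members-pairs κ =
      AllPairs.applyUpTo⁺₁ (member κ) K (λ i<j j<K → members-compatible {κ} {κ} (<⇒≤ i<j) j<K (inj₁ i<j))
    X-Y : All (λ e → All (Compatible e) (members Y)) (members X)
    X-Y = All.applyUpTo⁺₁ (member X) K λ {i} i<K → All.applyUpTo⁺₁ (member Y) K λ {j} j<K →
            Sum.[ (λ i≤j → members-compatible {X} {Y} i≤j j<K (inj₂ λ ()))
                     , (λ j≤i → compatible-sym (members-compatible {Y} {X} j≤i i<K (inj₂ λ ()))) ]′ (≤-total i j)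
    seam-members : All (λ e → All (Compatible e) (members X ++ members Y)) (map (λ O → ⟦ b ⊕ O ⟧) seam)
    seam-members = All.map⁺ (All.tabulate λ O∈ →
      All.++⁺ (All.applyUpTo⁺₁ (member X) K (seam-member O∈ X)) (All.applyUpTo⁺₁ (member Y) K (seam-member O∈ Y)))

  member∈ : ∀ κ {i} → i < K → member κ i ∈ₗ hyperedges
  member∈ X i<K = ∈-++⁺ʳ (map (λ O → ⟦ b ⊕ O ⟧) seam) (∈-++⁺ˡ (∈-applyUpTo⁺ (member X) i<K))
  member∈ Y i<K = ∈-++⁺ʳ (map (λ O → ⟦ b ⊕ O ⟧) seam) (∈-++⁺ʳ (members X) (∈-applyUpTo⁺ (member Y) i<K))

  window-edge : ∀ {O} → O ∈ₗ window → ⟦ b ⊕ O ⟧ ∈ₗ hyperedges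
  window-edge O∈ with ∈-++⁻ seam O∈
  ... | inj₁ O∈seam = ∈-++⁺ˡ (∈-map⁺ (λ O → ⟦ b ⊕ O ⟧) O∈seam)
  ... | inj₂ O∈tags with find (∈-concatMap⁻ familyTags {xs = families} O∈tags)
  ... | κ , _ , O∈κ with ∈-++⁻ (applyUpTo (lowTag κ) 3) O∈κ
  ... | inj₁ low with ∈-applyUpTo⁻ (lowTag κ) low
  ...   | i , i<3 , refl = subst (_∈ₗ hyperedges) (sym (lowTag≡ κ i)) (member∈ κ (<-≤-trans i<3 (m≤n+m 3 m)))
  window-edge O∈ | inj₂ O∈tags | κ , _ , O∈κ | inj₂ high with ∈-applyUpTo⁻ (highTag κ) high
  ...   | t , t<3 , refl = subst (_∈ₗ hyperedges) (sym (highTag≡ κ t)) (member∈ κ (+-monoʳ-< m t<3))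

  CoveredAt : Fin n → Set
  CoveredAt i = ∃₂ λ e f → e ∈ₗ hyperedges × f ∈ₗ hyperedges × e ∩ f ≡ cycEdge i

  window-cover : ∀ {s} → 8 ≤ s → s < 30 → CoveredAt (ι (b + s))
  window-cover {s} 8≤s s<30 =
    let O , O∈ , O′∈Any = find (All.lookup window-covers (∈-interval⁺ 8≤s s<30))
        O′ , O′∈ , O∩O′≡ = find O′∈Any
    in ⟦ b ⊕ O ⟧ , ⟦ b ⊕ O′ ⟧ , window-edge O∈ , window-edge O′∈ ,
       (begin
         ⟦ b ⊕ O ⟧ ∩ ⟦ b ⊕ O′ ⟧
           ≡⟨ ⟦⊕⟧-∩ b (All<-weaken 38≤n (All.lookup window-bounded O∈))
                      (All<-weaken 38≤n (All.lookup window-bounded O′∈)) ⟩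
         ⟦ b ⊕ (O ∩ₗ O′) ⟧      ≡⟨ cong (λ I → ⟦ b ⊕ I ⟧) O∩O′≡ ⟩
         ⟦ b ⊕ (s ∷ suc s ∷ []) ⟧ ≡⟨ ⟦⊕⟧-adjacent b s ⟩
         cycEdge (ι (b + s))    ∎)

  family-cover : ∀ u d y → u + d < K → d < 4 → edge32 (shape X) ∩ₗ (d * 3 ⊕ edge32 (shape Y)) ≡ y ∷ suc y ∷ [] →
                 CoveredAt (ι (u * 3 + y))
  family-cover u d y u+d<K d<4 X∩Y≡ =
    member X u , member Y (u + d) , member∈ X (≤-<-trans (m≤m+n u d) u+d<K) , member∈ Y u+d<K ,
    (begin
      member X u ∩ member Y (u + d)                         ≡⟨ cong (member X u ∩_) (member-shift Y u d) ⟨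
      ⟦ u * 3 ⊕ edge32 (shape X) ⟧ ∩ ⟦ u * 3 ⊕ d * 3 ⊕ edge32 (shape Y) ⟧
        ≡⟨ ⟦⊕⟧-∩ (u * 3) (All<-weaken 12≤n (shape-bounded X))
                         (All<-weaken d*3+12≤n (⊕-All< (d * 3) (shape-bounded Y))) ⟩
      ⟦ u * 3 ⊕ (edge32 (shape X) ∩ₗ (d * 3 ⊕ edge32 (shape Y))) ⟧ ≡⟨ cong (λ I → ⟦ u * 3 ⊕ I ⟧) X∩Y≡ ⟩
      ⟦ u * 3 ⊕ (y ∷ suc y ∷ []) ⟧                             ≡⟨ ⟦⊕⟧-adjacent (u * 3) y ⟩
      cycEdge (ι (u * 3 + y))                                  ∎)
    where
    d*3+12≤n : d * 3 + 12 ≤ n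
    d*3+12≤n = ≤-trans (+-monoˡ-≤ 12 (*-monoˡ-≤ 3 (≤-pred d<4))) 21≤n

  index<m : ∀ c t → 9 + (c + t * 3) < b + 8 → t < m
  index<m c t lt = *-cancelʳ-< 3 t m (<-trans (n<1+n (t * 3)) (+-cancelˡ-< 8 (suc (t * 3)) (m * 3) 9+t*3<8+b))
    where
    9+t*3<8+b : 9 + t * 3 < 8 + m * 3
    9+t*3<8+b = subst (9 + t * 3 <_) (+-comm (m * 3) 8) (≤-<-trans (+-monoʳ-≤ 9 (m≤n+m (t * 3) c)) lt)

  cover-middle : ∀ {y} → Residue3 y → 9 + y < b + 8 → CoveredAt (ι (9 + y))
  cover-middle (0+ t) lt = subst CoveredAt (cong ι (+-comm (t * 3) 9))
    (family-cover t 1 9 (+-mono-< (index<m 0 t lt) (s≤s (s≤s z≤n))) (s≤s (s≤s z≤n)) refl)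
  cover-middle (1+ t) lt = subst CoveredAt (cong ι (+-comm (t * 3) 10))
    (family-cover t 3 10 (+-monoˡ-< 3 (index<m 1 t lt)) (s≤s (s≤s (s≤s (s≤s z≤n)))) refl)
  cover-middle (2+ t) lt = subst CoveredAt (cong ι (eleven t))
    (family-cover (t + 3) 0 2 (subst (_< K) (sym (+-identityʳ (t + 3))) (+-monoˡ-< 3 (index<m 2 t lt))) (s≤s z≤n) refl)
    where
    eleven : ∀ t → (t + 3) * 3 + 2 ≡ 11 + t * 3
    eleven = solve-∀

  cover-position : ∀ x → x < n → CoveredAt (ι x)
  cover-position x x<n with x <? 10 | b + 8 ≤? x
  ... | yes x<10 | _ = subst CoveredAt (trans (cong ι (wrap b x)) (ι-+n x))
                         (window-cover (≤-trans (m≤m+n 8 12) (m≤m+n 20 x)) (+-monoʳ-< 20 x<10))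
    where
    wrap : ∀ b x → b + (20 + x) ≡ x + (20 + b)
    wrap = solve-∀
  ... | no _ | yes b+8≤x = subst CoveredAt (cong ι (m+[n∸m]≡n b≤x))
                             (window-cover (subst (_≤ x ∸ b) (m+n∸m≡n b 8) (∸-monoˡ-≤ b b+8≤x))
                                           (<-trans x∸b<20 (m<m+n 20 (s≤s z≤n))))
    where
    b≤x = ≤-trans (m≤m+n b 8) b+8≤x
    x∸b<20 = subst (x ∸ b <_) (m+n∸n≡m 20 b) (∸-monoˡ-< x<n b≤x)
  ... | no x≮10 | no b+8≰x = subst CoveredAt (cong ι (m+[n∸m]≡n 9≤x))
                               (cover-middle (residue3 (x ∸ 9)) (subst (_< b + 8) (sym (m+[n∸m]≡n 9≤x)) (≰⇒> b+8≰x)))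
    where
    9≤x = ≤-trans (n≤1+n 9) (≮⇒≥ x≮10)

  hyperedges-cover : Covers hyperedges
  hyperedges-cover i = subst CoveredAt (ι-toℕ i) (cover-position (toℕ i) (toℕ<n i))

-- For m < 6 the seam and the family members meeting it do not fit into n consecutive positions.
module _ (m : ℕ) where
  open Hypergraph m

  Decided : Set
  Decided = AllPairs Compatible hyperedges × (∀ i → CoveredBy hyperedges i)

  decided? : Dec Decided
  decided? = allPairs? compatible? hyperedges ×-dec Fin.all? (coveredBy? hyperedges)

  by-decision : Decided → AllPairs Compatible hyperedges × Covers hyperedges
  by-decision (pairs , covered) = pairs , coveredBy⇒covers covered

compatible-and-covering : ∀ m → let open Hypergraph m in AllPairs Compatible hyperedges × Covers hyperedges
compatible-and-covering 0 = by-decision 0 (from-yes (decided? 0))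
compatible-and-covering 1 = by-decision 1 (from-yes (decided? 1))
compatible-and-covering 2 = by-decision 2 (from-yes (decided? 2))
compatible-and-covering 3 = by-decision 3 (from-yes (decided? 3))
compatible-and-covering 4 = by-decision 4 (from-yes (decided? 4))
compatible-and-covering 5 = by-decision 5 (from-yes (decided? 5))
compatible-and-covering m@(suc (suc (suc (suc (suc (suc k)))))) =
  let open LargeHypergraph m (m≤m+n 6 k) in hyperedges-compatible , hyperedges-cover

Conclusion : ℕ → Set
Conclusion n = Σ (List (Subset n)) λ E →
      Unique E
      × All (λ e → ∣ e ∣ ≡ 5) E
      × EIisCycle E
      × length E ≡ 2 * ((n ∸ 2) / 3) + 1
      × Σ (Subset n) λ e₀ →
          e₀ L.∈ E × Is5Edge e₀
          × (∀ e → e L.∈ E → Is5Edge e → e ≡ e₀)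
          × (∀ e → e L.∈ E → e ≢ e₀ → Is32Edge e)

conclusion : ∀ m → Conclusion (20 + m * 3)
conclusion m =
  hyperedges , compatible⇒unique sizes pairs , sizes , EI-cycle 2≤n sizes pairs covers , length-hyperedges ,
  _ , here refl , five-edge , five-unique seam-family-32 , others-32 seam-family-32
  where
  open Hypergraph m
  pairs = proj₁ (compatible-and-covering m)
  covers = proj₂ (compatible-and-covering m)
  2≤n = ≤-trans (m≤m+n 2 18) 20≤n
  sizes : All (λ e → ∣ e ∣ ≡ 5) hyperedges
  sizes = ∣5-edge∣ (≤-trans (m≤m+n 5 15) 20≤n) five-edge
          ∷ All.map (∣32-edge∣ (≤-trans (m≤m+n 3 17) 20≤n)) seam-family-32

lemma3 : (n : ℕ) → 20 ≤ n → n % 3 ≡ 2 →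
    Σ (List (Subset n)) λ E →
      Unique E
      × All (λ e → ∣ e ∣ ≡ 5) E
      × EIisCycle E
      × length E ≡ 2 * ((n ∸ 2) / 3) + 1
      × Σ (Subset n) λ e₀ →
          e₀ L.∈ E × Is5Edge e₀
          × (∀ e → e L.∈ E → Is5Edge e → e ≡ e₀)
          × (∀ e → e L.∈ E → e ≢ e₀ → Is32Edge e)
lemma3 n 20≤n n%3≡2 = subst Conclusion (sym n≡20+m*3) (conclusion m)
  where
  q = n / 3
  m = q ∸ 6
  n≡2+q*3 : n ≡ 2 + q * 3
  n≡2+q*3 = trans (m≡m%n+[m/n]*n n 3) (cong (_+ q * 3) n%3≡2)
  6≤q : 6 ≤ q
  6≤q = *-cancelʳ-≤ 6 q 3 (+-cancelˡ-≤ 2 18 (q * 3) (subst (20 ≤_) n≡2+q*3 20≤n))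
  n≡20+m*3 : n ≡ 20 + m * 3
  n≡20+m*3 = trans n≡2+q*3 (cong (λ k → 2 + k * 3) (sym (m+[n∸m]≡n 6≤q)))
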